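{- Let $A$ be an integral domain of characteristic $p>0$ that is $p$-closed. If the perfection $A_{\operatorname{perf}}$ of $A$ is normal, then $A$ is normal.
   Context: An integral domain $A$ is $p$-closed if for every $a\in\operatorname{Frac}(A)$ with $a^p\in A$ one has $a\in A$. The perfection $A_{\operatorname{perf}}$ is the colimit of $A\xrightarrow{\mathrm{Fr}}A\xrightarrow{\mathrm{Fr}}\cdots$ along the Frobenius $x\mapsto x^p$ (equivalently, for a domain, the subring of an algebraic closure of $\operatorname{Frac}(A)$ of all $p^n$-th roots of elements of $A$). -}

module Defs where

open import Level using (_⊔_)
open import Data.Nat as ℕ using (ℕ; zero; suc)
open import Data.List using (List; []; _∷_)
open import Data.Product using (Σ; ∃; _×_; _,_; proj₁; proj₂)
open import Data.Sum using (_⊎_)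
open import Relation.Nullary using (¬_)
open import Algebra.Bundles using (CommutativeRing)
open import Algebra.Bundles.Raw using (RawRing)

module _ {c ℓ} (R : RawRing c ℓ) where
  open RawRing R

  pow : Carrier → ℕ → Carrier
  pow x zero    = 1#
  pow x (suc n) = x * pow x n

  natMul : ℕ → Carrier → Carrier
  natMul zero    x = 0#
  natMul (suc n) x = x + natMul n x

  -- Fraction field, standard construction: a pair (a , b) stands for a/b.
  -- Only pairs with b ≉ 0 are ever considered as elements (see below);
  -- all denominators produced by the operations are products of such b's.
  Frac : Set c
  Frac = Carrier × Carrier

  _≈F_ : Frac → Frac → Set ℓ
  (a , b) ≈F (a' , b') = a * b' ≈ a' * b

  _+F_ : Frac → Frac → Frac
  (a , b) +F (a' , b') = (a * b' + a' * b , b * b')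

  _*F_ : Frac → Frac → Frac
  (a , b) *F (a' , b') = (a * a' , b * b')

  ι : Carrier → Frac
  ι r = (r , 1#)

  powF : Frac → ℕ → Frac
  powF x zero    = ι 1#
  powF x (suc n) = x *F powF x n

  ValidFrac : Frac → Set ℓ
  ValidFrac (a , b) = ¬ (b ≈ 0#)

  -- Horner evaluation of the monic polynomial
  --   X^n + c_{n-1} X^{n-1} + ... + c_0
  -- given by the coefficient list  c_{n-1} ∷ ... ∷ c_0 ∷ [].
  hornerF : Frac → Frac → List Carrier → Frac
  hornerF x acc []       = acc
  hornerF x acc (c ∷ cs) = hornerF x ((acc *F x) +F ι c) cs

  evalMonic : List Carrier → Frac → Frac
  evalMonic cs x = hornerF x (ι 1#) cs

  IsIntegral : Frac → Set (c ⊔ ℓ)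
  IsIntegral x = ∃ λ (cs : List Carrier) → evalMonic cs x ≈F ι 0#

  InR : Frac → Set (c ⊔ ℓ)
  InR x = ∃ λ (r : Carrier) → ι r ≈F x

  IsNormal : Set (c ⊔ ℓ)
  IsNormal = ∀ (x : Frac) → ValidFrac x → IsIntegral x → InR x

  IsPClosed : ℕ → Set (c ⊔ ℓ)
  IsPClosed p = ∀ (x : Frac) → ValidFrac x → InR (powF x p) → InR x

module _ {c ℓ} (A : CommutativeRing c ℓ) where
  open CommutativeRing A

  IsIntegralDomain : Set (c ⊔ ℓ)
  IsIntegralDomain =
    ¬ (1# ≈ 0#) × (∀ x y → x * y ≈ 0# → (x ≈ 0#) ⊎ (y ≈ 0#))

  -- p · 1 = 0 in A (for p prime and A nonzero this means char A = p)
  HasCharDividing : ℕ → Set ℓ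
  HasCharDividing p = natMul rawRing p 1# ≈ 0#

-- The perfection of a domain A of characteristic p:
-- an element (a , n) stands for a^{1/p^n}.  Since Frobenius is injective on a
-- domain, the colimit of A --Fr--> A --Fr--> ... is the set of such pairs with
-- (a , n) ~ (b , m)  iff  a^{p^m} = b^{p^n}.

module _ {c ℓ} (A : CommutativeRing c ℓ) (p : ℕ) where
  open CommutativeRing A

  private
    P : ℕ → ℕ
    P n = p ℕ.^ n
    pw : Carrier → ℕ → Carrier
    pw = pow rawRing

  perfection : RawRing c ℓ
  perfection = record
    { Carrier = Carrier × ℕ
    ; _≈_     = λ { (a , n) (b , m) → pw a (P m) ≈ pw b (P n) }
    ; _+_     = λ { (a , n) (b , m) → (pw a (P m) + pw b (P n) , n ℕ.+ m) }
    ; _*_     = λ { (a , n) (b , m) → (pw a (P m) * pw b (P n) , n ℕ.+ m) }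
    ; -_      = λ { (a , n) → (- a , n) }
    ; 0#      = (0# , 0)
    ; 1#      = (1# , 0)
    }

{-# OPTIONS --safe #-}
-- Let x ∈ Frac A be integral over A.  Read in Frac A_perf through A ⊆ A_perf,
-- x satisfies the same monic equation, so by normality of A_perf it lies in
-- A_perf, i.e. x^(p^n) ∈ A for some n.  Applying p-closedness n times gives
-- x ∈ A.
module Submission where

open import Defs
open import Data.Nat as ℕ using (ℕ; zero; suc)
open import Data.Nat.Primality using (Prime)
open import Algebra.Bundles using (CommutativeRing)
open import Algebra.Bundles.Raw using (RawRing)
import Data.Nat.Properties as ℕₚ
open import Data.List using ([]; _∷_; map)
open import Data.Product using (∃; _×_; _,_; proj₁; proj₂)
open import Data.Sum using (inj₁; inj₂)
open import Relation.Binary.PropositionalEquality as ≡ using (_≡_; refl)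

module _ {c₁ ℓ₁ c₂ ℓ₂ ℓ} {R : RawRing c₁ ℓ₁} {S : RawRing c₂ ℓ₂}
  (_∼_ : Frac R → Frac S → Set ℓ)
  (f : RawRing.Carrier R → RawRing.Carrier S)
  (+F-∼ : ∀ {x x′ y y′} → x ∼ x′ → y ∼ y′ → _+F_ R x y ∼ _+F_ S x′ y′)
  (*F-∼ : ∀ {x x′ y y′} → x ∼ x′ → y ∼ y′ → _*F_ R x y ∼ _*F_ S x′ y′)
  (ι-∼ : ∀ c → ι R c ∼ ι S (f c))
  where

  hornerF-∼ : ∀ cs {x x′ acc acc′} → x ∼ x′ → acc ∼ acc′ →
              hornerF R x acc cs ∼ hornerF S x′ acc′ (map f cs)
  hornerF-∼ []       x∼x′ acc∼acc′ = acc∼acc′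
  hornerF-∼ (c ∷ cs) x∼x′ acc∼acc′ =
    hornerF-∼ cs x∼x′ (+F-∼ (*F-∼ acc∼acc′ x∼x′) (ι-∼ c))

module Powers {c ℓ} (A : CommutativeRing c ℓ) where
  open CommutativeRing A renaming (refl to ≈-refl)
  open import Relation.Binary.Reasoning.Setoid setoid
  import Algebra.Properties.CommutativeSemiring.Exp commutativeSemiring as Exp

  private
    R : RawRing c ℓ
    R = rawRing

  infixr 8 _^_
  _^_ : Carrier → ℕ → Carrier
  _^_ = pow R

  ^≡Exp^ : ∀ x n → x ^ n ≡ x Exp.^ n
  ^≡Exp^ x zero    = refl
  ^≡Exp^ x (suc n) = ≡.cong (x *_) (^≡Exp^ x n)

  ^-congˡ : ∀ {x y} n → x ≈ y → x ^ n ≈ y ^ n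
  ^-congˡ {x} {y} n x≈y rewrite ^≡Exp^ x n | ^≡Exp^ y n = Exp.^-congˡ n x≈y

  ^-assocʳ : ∀ x m n → (x ^ m) ^ n ≈ x ^ (m ℕ.* n)
  ^-assocʳ x m n rewrite ^≡Exp^ (x ^ m) n | ^≡Exp^ x m | ^≡Exp^ x (m ℕ.* n) =
    Exp.^-assocʳ x m n

  ^-identityʳ : ∀ x → x ^ 1 ≈ x
  ^-identityʳ = *-identityʳ

  powF≡^ : ∀ a b k → powF R (a , b) k ≡ (a ^ k , b ^ k)
  powF≡^ a b zero = refl
  powF≡^ a b (suc k) rewrite powF≡^ a b k = refl

  InR-cong : ∀ {a a′ b b′} → a ≈ a′ → b ≈ b′ → InR R (a , b) → InR R (a′ , b′)
  InR-cong {a} {a′} {b} {b′} a≈a′ b≈b′ (r , r*b≈a*1) = r , (begin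
    r * b′  ≈⟨ *-congˡ (sym b≈b′) ⟩
    r * b   ≈⟨ r*b≈a*1 ⟩
    a * 1#  ≈⟨ *-congʳ a≈a′ ⟩
    a′ * 1# ∎)

  module _ (dom : IsIntegralDomain A) where
    private
      1≉0 = proj₁ dom
      zero-product = proj₂ dom

    *F-valid : ∀ {x y} → ValidFrac R x → ValidFrac R y → ValidFrac R (_*F_ R x y)
    *F-valid {_ , b} {_ , d} b≉0 d≉0 bd≈0 with zero-product b d bd≈0
    ... | inj₁ b≈0 = b≉0 b≈0
    ... | inj₂ d≈0 = d≉0 d≈0

    powF-valid : ∀ {x} k → ValidFrac R x → ValidFrac R (powF R x k)
    powF-valid zero    x-valid = 1≉0
    powF-valid {x} (suc k) x-valid =
      *F-valid {x} {powF R x k} x-valid (powF-valid k x-valid)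

    IsPClosed-^ : ∀ {p} → IsPClosed R p → ∀ n → IsPClosed R (p ℕ.^ n)
    IsPClosed-^ pc zero (a , b) _ x¹∈A =
      InR-cong (^-identityʳ a) (^-identityʳ b) x¹∈A
    IsPClosed-^ {p} pc (suc n) x@(a , b) x-valid x^pp^n∈A =
      pc x x-valid (IsPClosed-^ pc n (powF R x p) (powF-valid p x-valid) x^p^p^n∈A)
      where
      x^p^p^n∈A : InR R (powF R (powF R x p) (p ℕ.^ n))
      x^p^p^n∈A rewrite powF≡^ a b p | powF≡^ (a ^ p) (b ^ p) (p ℕ.^ n) =
        InR-cong (sym (^-assocʳ a p (p ℕ.^ n))) (sym (^-assocʳ b p (p ℕ.^ n)))
          (≡.subst (InR R) (powF≡^ a b (p ℕ.* p ℕ.^ n)) x^pp^n∈A)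

module _ {c ℓ} (A : CommutativeRing c ℓ) (p : ℕ) where
  open CommutativeRing A renaming (refl to ≈-refl)
  open import Relation.Binary.Reasoning.Setoid setoid

  private
    R  = rawRing
    Aₚ = perfection A p

  open Powers A

  -- A sits in A_perf as the elements (a , 0); on these the operations of the
  -- perfection agree with those of A only up to factors  _ ^ (p ^ 0) = _ ^ 1.
  _lifts-to_ : Frac R → Frac Aₚ → Set ℓ
  (a , b) lifts-to ((u , n) , (v , m)) = n ≡ 0 × m ≡ 0 × u ≈ a × v ≈ b

  lift : Frac R → Frac Aₚ
  lift (a , b) = ((a , 0) , (b , 0))

  lift-lifts : ∀ x → x lifts-to lift x
  lift-lifts _ = refl , refl , ≈-refl , ≈-refl

  lifts-ι : ∀ a → ι R a lifts-to ι Aₚ (a , 0)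
  lifts-ι _ = refl , refl , ≈-refl , ≈-refl

  private
    level₀-* : ∀ {u v a b} → u ≈ a → v ≈ b → u ^ 1 * v ^ 1 ≈ a * b
    level₀-* u≈a v≈b =
      *-cong (trans (^-identityʳ _) u≈a) (trans (^-identityʳ _) v≈b)

  lifts-*F : ∀ {x X y Y} → x lifts-to X → y lifts-to Y →
             _*F_ R x y lifts-to _*F_ Aₚ X Y
  lifts-*F {_ , _} {(_ , _) , (_ , _)} {_ , _} {(_ , _) , (_ , _)}
    (refl , refl , u≈a , v≈b) (refl , refl , u′≈a′ , v′≈b′) =
    refl , refl , level₀-* u≈a u′≈a′ , level₀-* v≈b v′≈b′

  lifts-+F : ∀ {x X y Y} → x lifts-to X → y lifts-to Y →
             _+F_ R x y lifts-to _+F_ Aₚ X Y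
  lifts-+F {_ , _} {(_ , _) , (_ , _)} {_ , _} {(_ , _) , (_ , _)}
    (refl , refl , u≈a , v≈b) (refl , refl , u′≈a′ , v′≈b′) =
    refl , refl ,
    +-cong (trans (^-identityʳ _) (level₀-* u≈a v′≈b′))
           (trans (^-identityʳ _) (level₀-* u′≈a′ v≈b)) ,
    level₀-* v≈b v′≈b′

  lifts-≈F : ∀ {x X y Y} → x lifts-to X → y lifts-to Y →
             _≈F_ R x y → _≈F_ Aₚ X Y
  lifts-≈F {a , b} {(u , _) , (v , _)} {a′ , b′} {(u′ , _) , (v′ , _)}
    (refl , refl , u≈a , v≈b) (refl , refl , u′≈a′ , v′≈b′) ab′≈a′b = begin
    (u ^ 1 * v′ ^ 1) ^ 1 ≈⟨ ^-identityʳ _ ⟩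
    u ^ 1 * v′ ^ 1       ≈⟨ level₀-* u≈a v′≈b′ ⟩
    a * b′               ≈⟨ ab′≈a′b ⟩
    a′ * b               ≈⟨ level₀-* u′≈a′ v≈b ⟨
    u′ ^ 1 * v ^ 1       ≈⟨ ^-identityʳ _ ⟨
    (u′ ^ 1 * v ^ 1) ^ 1 ∎

  lifts-valid : ∀ {x X} → x lifts-to X → ValidFrac R x → ValidFrac Aₚ X
  lifts-valid {_ , b} {(_ , _) , (v , _)} (refl , refl , _ , v≈b) b≉0 v¹≈0¹ =
    b≉0 (begin
      b     ≈⟨ trans (^-identityʳ v) v≈b ⟨
      v ^ 1 ≈⟨ v¹≈0¹ ⟩
      0# ^ 1 ≈⟨ ^-identityʳ 0# ⟩
      0#    ∎)

  lifts-integral : ∀ {x X} → x lifts-to X → IsIntegral R x → IsIntegral Aₚ X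
  lifts-integral x↑X (cs , monic[x]≈0) =
    map (_, 0) cs ,
    lifts-≈F (hornerF-∼ _lifts-to_ (_, 0) lifts-+F lifts-*F lifts-ι cs x↑X (lifts-ι 1#))
             (lifts-ι 0#) monic[x]≈0

  lifts-InR : ∀ {x X} → x lifts-to X → InR Aₚ X →
              ∃ λ n → InR R (powF R x (p ℕ.^ n))
  lifts-InR {a , b} {(u , _) , (v , _)} (refl , refl , u≈a , v≈b) ((r , n) , e)
    = n , ≡.subst (InR R) (≡.sym (powF≡^ a b N)) (r , (begin
      r * b ^ N                     ≈⟨ *-cong (^-identityʳ r) (^-congˡ N v≈b) ⟨
      r ^ 1 * v ^ N                 ≈⟨ ^-identityʳ _ ⟨
      (r ^ 1 * v ^ N) ^ 1           ≈⟨ e ⟩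
      (u ^ 1 * 1# ^ 1) ^ (p ℕ.^ (n ℕ.+ 0))
        ≡⟨ ≡.cong (λ k → (u ^ 1 * 1# ^ 1) ^ (p ℕ.^ k)) (ℕₚ.+-identityʳ n) ⟩
      (u ^ 1 * 1# ^ 1) ^ N          ≈⟨ ^-congˡ N (trans (level₀-* u≈a ≈-refl) (*-identityʳ a)) ⟩
      a ^ N                         ≈⟨ *-identityʳ _ ⟨
      a ^ N * 1#                    ∎))
    where N = p ℕ.^ n

lemma2p4 : ∀ {c ℓ} (A : CommutativeRing c ℓ) (p : ℕ) → Prime p →
    IsIntegralDomain A → HasCharDividing A p →
    IsPClosed (CommutativeRing.rawRing A) p →
    IsNormal (perfection A p) →
    IsNormal (CommutativeRing.rawRing A)
lemma2p4 A p _ dom _ p-closed Aₚ-normal x x-valid x-integral =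
  let x↑ = lift-lifts A p x
      x∈Aₚ = Aₚ-normal (lift A p x) (lifts-valid A p x↑ x-valid)
                       (lifts-integral A p x↑ x-integral)
      n , x^p^n∈A = lifts-InR A p x↑ x∈Aₚ
  in Powers.IsPClosed-^ A dom p-closed n x x-valid x^p^n∈A
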